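{- The independence number is stable under 2-switch: for every graph $G$ and every 2-switch $\tau$, $|\alpha(\tau(G))-\alpha(G)|\le 1$.
   Context: Graphs are finite, simple, undirected and labeled. $\alpha(G)$ is the maximum cardinality of a set of pairwise non-adjacent vertices of $G$. For vertices $a,b,c,d$, the 2-switch $\tau=\binom{a\ b}{c\ d}$ maps $G$ to $G-ab-cd+ac+bd$ if $ab,cd\in E(G)$, $\{a,b\}\cap\{c,d\}=\varnothing$ and $ac,bd\notin E(G)$, and to $G$ otherwise. -}

module Defs where

open import Data.Nat using (ℕ; _≤_)
open import Data.Bool using (Bool; true; false; _∧_; _∨_; not; if_then_else_)
open import Data.Fin using (Fin)
open import Data.Fin.Properties using (_≟_)
open import Data.Fin.Subset using (Subset; _∈_; ∣_∣)
open import Data.Product using (Σ; _×_)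
open import Relation.Nullary.Decidable using (⌊_⌋)
open import Relation.Binary.PropositionalEquality using (_≡_)

record Graph (n : ℕ) : Set where
  field
    adj     : Fin n → Fin n → Bool
    symm    : ∀ x y → adj x y ≡ adj y x
    irrefl  : ∀ x → adj x x ≡ false

open Graph public

_==_ : ∀ {n} → Fin n → Fin n → Bool
x == y = ⌊ x ≟ y ⌋

samePair : ∀ {n} → Fin n → Fin n → Fin n → Fin n → Bool
samePair u v x y = ((x == u) ∧ (y == v)) ∨ ((x == v) ∧ (y == u))

applicable : ∀ {n} → Graph n → (a b c d : Fin n) → Bool
applicable G a b c d =
  adj G a b ∧ adj G c d
  ∧ not (a == c) ∧ not (a == d) ∧ not (b == c) ∧ not (b == d)
  ∧ not (adj G a c) ∧ not (adj G b d)

switchedAdj : ∀ {n} → Graph n → (a b c d : Fin n) → Fin n → Fin n → Bool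
switchedAdj G a b c d x y =
  if samePair a b x y ∨ samePair c d x y then false
  else if samePair a c x y ∨ samePair b d x y then true
  else adj G x y

twoSwitchAdj : ∀ {n} → Graph n → (a b c d : Fin n) → Fin n → Fin n → Bool
twoSwitchAdj G a b c d x y =
  if applicable G a b c d then switchedAdj G a b c d x y else adj G x y

Independent : ∀ {n} → (Fin n → Fin n → Bool) → Subset n → Set
Independent E S = ∀ x y → x ∈ S → y ∈ S → E x y ≡ false

IsIndependenceNumber : ∀ {n} → (Fin n → Fin n → Bool) → ℕ → Set
IsIndependenceNumber {n} E k =
  Σ (Subset n) (λ S → Independent E S × ∣ S ∣ ≡ k)
  × (∀ (S : Subset n) → Independent E S → ∣ S ∣ ≤ k)

-- An independent set S of G
-- can only fail to be independent in τ(G) through the new edges ac and bd;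
-- since ab is an edge of G, S does not contain both a and b, so deleting a
-- (if ac ⊆ S) or else b (if bd ⊆ S) leaves an independent set of τ(G).
-- Symmetrically, with the removed edges ab and cd and the new edge ac, an
-- independent set of τ(G) loses at most one vertex to become independent
-- in G.
module Submission where

open import Defs
open import Data.Nat using (ℕ; _≤_; _+_; s≤s)
open import Data.Nat.Properties using (≤-trans; ≤-reflexive; +-comm; +-monoˡ-≤; m≤m+n)
open import Data.Fin using (Fin; zero; suc)
open import Data.Fin.Properties using (_≟_)
open import Data.Fin.Subset using (Subset; _∈_; _∉_; _⊆_; _─_; _-_; ⊥; ∣_∣; inside; outside)
open import Data.Fin.Subset.Properties using (_∈?_; p─⊥≡p; p─q⊆p)
open import Data.Vec using (_∷_; there)
open import Data.Bool using (Bool; true; false; T; _∧_; _∨_)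
open import Data.Bool.Properties using (T-≡; T-∨; T-∧; ∧-conicalˡ; ∧-zeroʳ)
open import Data.Product using (Σ-syntax; _×_; _,_; proj₁; map)
open import Data.Sum using (_⊎_; inj₁; inj₂; [_,_])
open import Data.Empty using (⊥-elim)
open import Function using (_∘_)
open import Function.Bundles using (Equivalence)
open import Relation.Nullary using (¬_; Dec; yes; no)
open import Relation.Nullary.Decidable using (_×-dec_; toWitness; isYes≗does; dec-true; dec-false)
open import Relation.Binary.PropositionalEquality using (_≡_; _≢_; refl; sym; trans; cong)

private
  variable
    n : ℕ
    E E′ : Fin n → Fin n → Bool

x∉p-x : ∀ (p : Subset n) x → x ∉ p - x
x∉p-x (_ ∷ p) zero    ()
x∉p-x (_ ∷ p) (suc x) (there x∈p-x) = x∉p-x p x x∈p-x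

-- The tail of p - zero is p ─ ⊥ only up to conversion (the local diff of _─_),
-- so p─⊥≡p cannot be used by rewrite.
∣p∣+1≡∣p─⊥∣+1 : ∀ (p : Subset n) → ∣ p ∣ + 1 ≡ ∣ p ─ ⊥ ∣ + 1
∣p∣+1≡∣p─⊥∣+1 p = cong (λ q → ∣ q ∣ + 1) (sym (p─⊥≡p p))

∣p∣≤∣p-x∣+1 : ∀ (p : Subset n) x → ∣ p ∣ ≤ ∣ p - x ∣ + 1
∣p∣≤∣p-x∣+1 (inside  ∷ p) zero    = ≤-reflexive (trans (+-comm 1 ∣ p ∣) (∣p∣+1≡∣p─⊥∣+1 p))
∣p∣≤∣p-x∣+1 (outside ∷ p) zero    = ≤-trans (m≤m+n ∣ p ∣ 1) (≤-reflexive (∣p∣+1≡∣p─⊥∣+1 p))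
∣p∣≤∣p-x∣+1 (inside  ∷ p) (suc x) = s≤s (∣p∣≤∣p-x∣+1 p x)
∣p∣≤∣p-x∣+1 (outside ∷ p) (suc x) = ∣p∣≤∣p-x∣+1 p x

==-refl : ∀ (x : Fin n) → x == x ≡ true
==-refl x = trans (isYes≗does (x ≟ x)) (dec-true (x ≟ x) refl)

≢⇒==-false : ∀ {x y : Fin n} → x ≢ y → x == y ≡ false
≢⇒==-false {x = x} {y} x≢y = trans (isYes≗does (x ≟ y)) (dec-false (x ≟ y) x≢y)

BothIn : Subset n → Fin n → Fin n → Set
BothIn S u v = u ∈ S × v ∈ S

SamePair : Fin n → Fin n → Fin n → Fin n → Set
SamePair u v x y = (x ≡ u × y ≡ v) ⊎ (x ≡ v × y ≡ u)

samePair-∨⇒SamePair : ∀ {u v u′ v′ x y : Fin n} → samePair u v x y ∨ samePair u′ v′ x y ≡ true →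
                      SamePair u v x y ⊎ SamePair u′ v′ x y
samePair-∨⇒SamePair {x = x} {y} =
  Data.Sum.map sameAs sameAs ∘ Equivalence.to T-∨ ∘ Equivalence.from T-≡
  where
  pair : ∀ {s t} → T ((x == s) ∧ (y == t)) → x ≡ s × y ≡ t
  pair {s} {t} = map toWitness toWitness ∘ Equivalence.to (T-∧ {x == s} {y == t})

  sameAs : ∀ {s t} → T (samePair s t x y) → SamePair s t x y
  sameAs = Data.Sum.map pair pair ∘ Equivalence.to T-∨

SamePair⇒BothIn : ∀ {S : Subset n} {u v x y} → SamePair u v x y → x ∈ S → y ∈ S → BothIn S u v
SamePair⇒BothIn (inj₁ (refl , refl)) x∈S y∈S = x∈S , y∈S
SamePair⇒BothIn (inj₂ (refl , refl)) x∈S y∈S = y∈S , x∈S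

Independent-antitone : ∀ {S T : Subset n} → T ⊆ S → Independent E S → Independent E T
Independent-antitone T⊆S indep x y x∈T y∈T = indep x y (T⊆S x∈T) (T⊆S y∈T)

adjacent⇒∉ : ∀ {S : Subset n} {u v} → Independent E S → E u v ≡ true → u ∈ S → v ∉ S
adjacent⇒∉ indep uv u∈S v∈S with () ← trans (sym uv) (indep _ _ u∈S v∈S)

NewEdgesAmong : (E E′ : Fin n → Fin n → Bool) (p q r s : Fin n) → Set
NewEdgesAmong E E′ p q r s =
  ∀ {x y} → E′ x y ≡ true → E x y ≡ false → SamePair p q x y ⊎ SamePair r s x y

Independent-avoiding : ∀ {p q r s} {S : Subset n} → NewEdgesAmong E E′ p q r s → Independent E S →
                       ¬ BothIn S p q → ¬ BothIn S r s → Independent E′ S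
Independent-avoiding {E = E} {E′ = E′} new indep ¬pq ¬rs x y x∈S y∈S
  with E′ x y in e′
... | false = refl
... | true  = ⊥-elim ([ ¬pq ∘ inS , ¬rs ∘ inS ] (new e′ (indep x y x∈S y∈S)))
  where inS = λ {u v} (xy≡uv : SamePair u v x y) → SamePair⇒BothIn xy≡uv x∈S y∈S

ShrinksToIndependent : (E E′ : Fin n → Fin n → Bool) → Set
ShrinksToIndependent {n} E E′ =
  ∀ (S : Subset n) → Independent E S → Σ[ T ∈ Subset n ] Independent E′ T × ∣ S ∣ ≤ ∣ T ∣ + 1

ShrinksToIndependent-refl : ShrinksToIndependent E E
ShrinksToIndependent-refl S indep = S , indep , m≤m+n ∣ S ∣ 1

-- Deleting p from S kills both new edges when pq ⊆ S (then r ∉ S, as pr ∈ E);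
-- otherwise deleting r kills the only possible one, rs.
ShrinksToIndependent-twoPairs : ∀ {p q r s : Fin n} → NewEdgesAmong E E′ p q r s → E p r ≡ true →
                                ShrinksToIndependent E E′
ShrinksToIndependent-twoPairs {n} {E} {E′} {p} {q} {r} {s} new pr S indep =
  by-cases (p ∈? S ×-dec q ∈? S) (r ∈? S ×-dec s ∈? S)
  where
  Shrunk : Set
  Shrunk = Σ[ T ∈ Subset n ] Independent E′ T × ∣ S ∣ ≤ ∣ T ∣ + 1

  deleting : ∀ v → ¬ BothIn (S - v) p q → ¬ BothIn (S - v) r s → Shrunk
  deleting v ¬pq ¬rs =
    S - v , Independent-avoiding new (Independent-antitone (p─q⊆p S _) indep) ¬pq ¬rs ,
    ∣p∣≤∣p-x∣+1 S v

  by-cases : Dec (BothIn S p q) → Dec (BothIn S r s) → Shrunk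
  by-cases (yes (p∈S , _)) _ =
    deleting p (x∉p-x S p ∘ proj₁) (adjacent⇒∉ indep pr p∈S ∘ p─q⊆p S _ ∘ proj₁)
  by-cases (no ¬pq) (yes _) =
    deleting r (¬pq ∘ map (p─q⊆p S _) (p─q⊆p S _)) (x∉p-x S r ∘ proj₁)
  by-cases (no ¬pq) (no ¬rs) = S , Independent-avoiding new indep ¬pq ¬rs , m≤m+n ∣ S ∣ 1

independenceNumber-≤-+1 : ShrinksToIndependent E E′ → ∀ {k k′} →
                          IsIndependenceNumber E k → IsIndependenceNumber E′ k′ → k ≤ k′ + 1
independenceNumber-≤-+1 shrinks ((S , indep , refl) , _) (_ , maximal′)
  with T , indep′ , ∣S∣≤∣T∣+1 ← shrinks S indep =
  ≤-trans ∣S∣≤∣T∣+1 (+-monoˡ-≤ 1 (maximal′ T indep′))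

independenceNumbers-close : ShrinksToIndependent E E′ → ShrinksToIndependent E′ E → ∀ {k k′} →
                            IsIndependenceNumber E k → IsIndependenceNumber E′ k′ →
                            (k ≤ k′ + 1) × (k′ ≤ k + 1)
independenceNumbers-close shrinks unshrinks α α′ =
  independenceNumber-≤-+1 shrinks α α′ , independenceNumber-≤-+1 unshrinks α′ α

module _ (G : Graph n) (a b c d : Fin n) where

  applicable⇒adj : applicable G a b c d ≡ true → adj G a b ≡ true
  applicable⇒adj = ∧-conicalˡ (adj G a b) _

  applicable⇒distinct : applicable G a b c d ≡ true → a ≢ c × a ≢ d × b ≢ c
  applicable⇒distinct app with adj G a b | adj G c d | a ≟ c | a ≟ d | b ≟ c
  ... | true | true | no a≢c | no a≢d | no b≢c = a≢c , a≢d , b≢c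
  applicable⇒distinct () | false | _     | _     | _     | _
  applicable⇒distinct () | true  | false | _     | _     | _
  applicable⇒distinct () | true  | true  | yes _ | _     | _
  applicable⇒distinct () | true  | true  | no _  | yes _ | _
  applicable⇒distinct () | true  | true  | no _  | no _  | yes _

  switchedAdj-added : NewEdgesAmong (adj G) (switchedAdj G a b c d) a c b d
  switchedAdj-added {x} {y} added absent
    with samePair a b x y ∨ samePair c d x y
       | samePair a c x y ∨ samePair b d x y in new
  ... | false | true  = samePair-∨⇒SamePair new
  ... | false | false with () ← trans (sym added) absent

  switchedAdj-removed : NewEdgesAmong (switchedAdj G a b c d) (adj G) a b c d
  switchedAdj-removed {x} {y} present removed
    with samePair a b x y ∨ samePair c d x y in old
  ... | true  = samePair-∨⇒SamePair old
  ... | false with samePair a c x y ∨ samePair b d x y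
  ...   | false with () ← trans (sym present) removed

  switchedAdj-ac : a ≢ c → a ≢ d → b ≢ c → switchedAdj G a b c d a c ≡ true
  switchedAdj-ac a≢c a≢d b≢c
    rewrite ==-refl a | ==-refl c
          | ≢⇒==-false a≢c | ≢⇒==-false a≢d
          | ≢⇒==-false (a≢c ∘ sym) | ≢⇒==-false (b≢c ∘ sym)
          | ∧-zeroʳ (a == b) = refl

  applicable⇒shrinks : applicable G a b c d ≡ true →
                       ShrinksToIndependent (adj G) (switchedAdj G a b c d)
  applicable⇒shrinks app = ShrinksToIndependent-twoPairs switchedAdj-added (applicable⇒adj app)

  applicable⇒unshrinks : applicable G a b c d ≡ true →
                         ShrinksToIndependent (switchedAdj G a b c d) (adj G)
  applicable⇒unshrinks app with a≢c , a≢d , b≢c ← applicable⇒distinct app =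
    ShrinksToIndependent-twoPairs switchedAdj-removed (switchedAdj-ac a≢c a≢d b≢c)

theorem10 : ∀ (n : ℕ) (G : Graph n) (a b c d : Fin n) (k k′ : ℕ)
    → IsIndependenceNumber (adj G) k
    → IsIndependenceNumber (twoSwitchAdj G a b c d) k′
    → (k ≤ k′ + 1) × (k′ ≤ k + 1)
-- The with-abstraction also rewrites the test inside twoSwitchAdj in the type of
-- α′, which thereby becomes an independence number of switchedAdj G a b c d or of adj G.
theorem10 n G a b c d k k′ α α′ with applicable G a b c d in app
... | true  = independenceNumbers-close
                (applicable⇒shrinks G a b c d app) (applicable⇒unshrinks G a b c d app) α α′
... | false = independenceNumbers-close ShrinksToIndependent-refl ShrinksToIndependent-refl α α′
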